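{- Let $G$, $s,t,F$ and a feasible flow $f$ (all residual capacities positive) be as in the context, let $r$ be the resistances determined by $f$ in $G$, let $\tilde f$ be the electrical $\chi$-flow determined by $r$ in $G$, and let $\rho$ be its congestion vector. Let $S$ be a set of arcs of $G$, let $G'$ be the graph obtained from $G$ by boosting every arc of $S$ (with the flow $f$ transformed accordingly into a flow $f'$ on $G'$), let $r'$ be the resistances determined by $f'$ in $G'$, and let $\tilde f'$ be the electrical $\chi$-flow determined by $r'$ in $G'$. Then \[\mathcal{E}_{r'}(\tilde f')\ge\left(1+\frac18\sum_{e\in S}\frac{\rho_e^2}{\|\rho\|_2^2}\right)\mathcal{E}_r(\tilde f).\]
   Context: $G=(V,E,\mathbf{u})$ is a directed multigraph; each arc $e=(u,v)$ has nonnegative integer capacities $u_e^-,u_e^+$; $U$ is the largest capacity. A flow $g$ is a $\sigma$-flow if for each vertex inflow minus outflow (by orientation) equals $\sigma_v$; feasible if $-u_e^-\le g_e\le u_e^+$. $\chi=F\chi_{s,t}$ where $\chi_{s,t}$ has $-1$ at $s$, $+1$ at $t$, $0$ elsewhere. Residual capacities $\hat u_e^+(f)=u_e^+-f_e$, $\hat u_e^-(f)=u_e^-+f_e$, $\hat u_e(f)=\min$ of the two; $\Phi_e(f)=\hat u_e^+(f)^{ -1}-\hat u_e^-(f)^{ -1}$. Resistances determined by $f$: $r_e=\hat u_e^+(f)^{ -2}+\hat u_e^-(f)^{ -2}$ (a term with infinite capacity is $0$). Energy $\mathcal{E}_r(g)=\sum_er_eg_e^2$; the electrical $\sigma$-flow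 is the $\sigma$-flow of minimum energy. Congestion vector: $\rho_e=\tilde f_e/\hat u_e(f)$. Boosting an arc $e=(u,v)$ with $\hat u_e^+(f)=\hat u_e(f)$: replace $e$ by a $u$-$v$ path of $\beta(e)=2+\lceil 2U/\hat u_e(f)\rceil$ arcs $e_1,\dots,e_{\beta(e)}$ all oriented towards $v$; $e_1,e_2$ are copies of $e$ ($u_{e_i}^\pm=u_e^\pm$); for $2<i\le\beta(e)$, $u_{e_i}^+=+\infty$ and $u_{e_i}^-=\tilde u:=\frac{\beta(e)-2}{\Phi_e(f)}-f_e$; the flow value $f_e$ is sent along every arc of the path. If instead $\hat u_e^-(f)<\hat u_e^+(f)$, the construction is symmetric (roles of forward and backward capacities exchanged). -}

module Defs where

open import Data.Bool using (Bool; true; false; if_then_else_)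
open import Data.Nat as ℕ using (ℕ; zero; suc; _≡ᵇ_)
open import Data.Integer as ℤ using (ℤ; +_; ∣_∣)
open import Data.Fin using (Fin; toℕ) renaming (zero to fzero; suc to fsuc)
open import Data.Fin.Properties using () renaming (_≟_ to _≟F_)
open import Data.Fin.Subset using (Subset; _∈_)
open import Data.Fin.Subset.Properties using (_∈?_)
open import Data.List as List using (List; []; _∷_; length; lookup; concatMap; allFin; upTo; map)
open import Data.Product using (_×_; _,_; proj₁; proj₂)
open import Data.Sum using (_⊎_; inj₁; inj₂)
import Data.Sum.Properties as SumP
import Data.Product.Properties as ProdP
open import Data.Rational using (ℚ; 0ℚ; 1ℚ; _+_; _-_; _*_; -_; _≤_; _≤ᵇ_; _⊓_; 1/_; ≢-nonZero; ceiling; _/_)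
open import Data.Rational.Properties using (_≟_)
open import Relation.Binary.Definitions using (DecidableEquality)
open import Relation.Binary.PropositionalEquality using (_≡_)
open import Relation.Nullary using (yes; no; does)

ℕ→ℚ : ℕ → ℚ
ℕ→ℚ n = + n / 1

-- total inverse: inv 0 = 0 (only ever applied to nonzero values below,
-- except where the zero case is treated explicitly)
inv : ℚ → ℚ
inv q with q ≟ 0ℚ
... | yes _ = 0ℚ
... | no q≢0 = 1/_ q {{≢-nonZero q≢0}}

∑ : ∀ {m} → (Fin m → ℚ) → ℚ
∑ {zero} g = 0ℚ
∑ {suc m} g = g fzero + ∑ (λ i → g (fsuc i))

maxF : ∀ {m} → (Fin m → ℕ) → ℕ
maxF {zero} g = 0
maxF {suc m} g = g fzero ℕ.⊔ maxF (λ i → g (fsuc i))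

data Cap : Set where
  fin : ℚ → Cap
  ∞   : Cap

invSq : Cap → ℚ
invSq (fin c) = inv (c * c)
invSq ∞ = 0ℚ

resid⁺ : Cap → ℚ → Cap
resid⁺ (fin c) x = fin (c - x)
resid⁺ ∞ x = ∞

resid⁻ : Cap → ℚ → Cap
resid⁻ (fin c) x = fin (c + x)
resid⁻ ∞ x = ∞

record Digraph (V : Set) : Set where
  field
    m    : ℕ
    tl   : Fin m → V
    hd   : Fin m → V
    cap⁺ : Fin m → Cap
    cap⁻ : Fin m → Cap
open Digraph public

Flow : ∀ {V} → Digraph V → Set
Flow G = Fin (m G) → ℚ

resistance : ∀ {V} (G : Digraph V) → Flow G → Fin (m G) → ℚ
resistance G f e = invSq (resid⁺ (cap⁺ G e) (f e)) + invSq (resid⁻ (cap⁻ G e) (f e))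

energy : ∀ {V} (G : Digraph V) → (Fin (m G) → ℚ) → Flow G → ℚ
energy G r g = ∑ (λ e → r e * (g e * g e))

ind : ∀ {V : Set} → DecidableEquality V → V → V → ℚ → ℚ
ind dec x v q = if does (dec x v) then q else 0ℚ

netIn : ∀ {V} → DecidableEquality V → (G : Digraph V) → Flow G → V → ℚ
netIn dec G g v = ∑ (λ e → ind dec (hd G e) v (g e) - ind dec (tl G e) v (g e))

IsFlow : ∀ {V} → DecidableEquality V → (G : Digraph V) → (V → ℚ) → Flow G → Set
IsFlow dec G σ g = ∀ v → netIn dec G g v ≡ σ v

IsElectrical : ∀ {V} → DecidableEquality V → (G : Digraph V) → (Fin (m G) → ℚ) → (V → ℚ) → Flow G → Set
IsElectrical dec G r σ g = IsFlow dec G σ g × (∀ h → IsFlow dec G σ h → energy G r g ≤ energy G r h)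

chi : ∀ {V} → DecidableEquality V → ℚ → V → V → V → ℚ
chi dec F s t v = ind dec t v F - ind dec s v F

record Network (n : ℕ) : Set where
  field
    arcs : ℕ
    tail : Fin arcs → Fin n
    head : Fin arcs → Fin n
    u⁺   : Fin arcs → ℕ
    u⁻   : Fin arcs → ℕ
open Network public

toDigraph : ∀ {n} → Network n → Digraph (Fin n)
toDigraph N = record { m = arcs N ; tl = tail N ; hd = head N
                     ; cap⁺ = λ e → fin (ℕ→ℚ (u⁺ N e)) ; cap⁻ = λ e → fin (ℕ→ℚ (u⁻ N e)) }

module _ {n : ℕ} (N : Network n) (f : Fin (arcs N) → ℚ) where

  StrictlyFeasible : Set
  StrictlyFeasible = ∀ e → (- ℕ→ℚ (u⁻ N e) < f e) × (f e < ℕ→ℚ (u⁺ N e))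
    where open import Data.Rational using (_<_)

  res⁺ res⁻ ures Φ : Fin (arcs N) → ℚ
  res⁺ e = ℕ→ℚ (u⁺ N e) - f e
  res⁻ e = ℕ→ℚ (u⁻ N e) + f e
  ures e = res⁺ e ⊓ res⁻ e
  Φ e = inv (res⁺ e) - inv (res⁻ e)

  Umax : ℕ
  Umax = maxF (λ e → u⁺ N e ℕ.⊔ u⁻ N e)

  β : Fin (arcs N) → ℕ
  β e = 2 ℕ.+ ∣ ceiling (ℕ→ℚ (2 ℕ.* Umax) * inv (ures e)) ∣

  -- vertices of the boosted graph: old vertices, and inj₂ (j , i) is the
  -- i-th internal vertex (1 ≤ i < β) of the path replacing arc j
  V' : Set
  V' = Fin n ⊎ (ℕ × ℕ)

  decV' : DecidableEquality V'
  decV' = SumP.≡-dec _≟F_ (ProdP.≡-dec ℕ._≟_ ℕ._≟_)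

  record ArcF : Set where
    constructor arcF
    field
      a-tl a-hd : V'
      a-cap⁺ a-cap⁻ : Cap
      a-flow : ℚ

  newCaps : Fin (arcs N) → Cap × Cap
  newCaps e =
    if res⁺ e ≤ᵇ res⁻ e
    then (∞ , (if does (Φ e ≟ 0ℚ) then ∞
               else fin (ℕ→ℚ (β e ℕ.∸ 2) * inv (Φ e) - f e)))
    else (fin (ℕ→ℚ (β e ℕ.∸ 2) * inv (- Φ e) + f e) , ∞)

  -- the path e_1 … e_β replacing arc e  (index i = 0 … β-1 is arc e_{i+1})
  pathArcs : Fin (arcs N) → List ArcF
  pathArcs e = map mk (upTo (β e))
    where
      j = toℕ e
      mk : ℕ → ArcF
      mk i = arcF (if i ≡ᵇ 0 then inj₁ (tail N e) else inj₂ (j , i))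
                  (if suc i ≡ᵇ β e then inj₁ (head N e) else inj₂ (j , suc i))
                  (if i ℕ.<ᵇ 2 then fin (ℕ→ℚ (u⁺ N e)) else proj₁ (newCaps e))
                  (if i ℕ.<ᵇ 2 then fin (ℕ→ℚ (u⁻ N e)) else proj₂ (newCaps e))
                  (f e)

  keepArc : Fin (arcs N) → ArcF
  keepArc e = arcF (inj₁ (tail N e)) (inj₁ (head N e))
                   (fin (ℕ→ℚ (u⁺ N e))) (fin (ℕ→ℚ (u⁻ N e))) (f e)

  boostedArcs : Subset (arcs N) → List ArcF
  boostedArcs S = concatMap (λ e → if does (e ∈? S) then pathArcs e else keepArc e ∷ []) (allFin (arcs N))

  boostedGraph : Subset (arcs N) → Digraph V'
  boostedGraph S = record
    { m = length (boostedArcs S)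
    ; tl = λ i → ArcF.a-tl (lookup (boostedArcs S) i)
    ; hd = λ i → ArcF.a-hd (lookup (boostedArcs S) i)
    ; cap⁺ = λ i → ArcF.a-cap⁺ (lookup (boostedArcs S) i)
    ; cap⁻ = λ i → ArcF.a-cap⁻ (lookup (boostedArcs S) i) }

  boostedFlow : (S : Subset (arcs N)) → Flow (boostedGraph S)
  boostedFlow S i = ArcF.a-flow (lookup (boostedArcs S) i)

  congestion : (Fin (arcs N) → ℚ) → Fin (arcs N) → ℚ
  congestion g e = g e * inv (ures e)

  ∑∈ : Subset (arcs N) → (Fin (arcs N) → ℚ) → ℚ
  ∑∈ S x = ∑ (λ e → if does (e ∈? S) then x e else 0ℚ)

module Submission where

-- The electrical flow f̃′ of G′ projects to a χ-flow g of G: conservation at the inner vertices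
-- of a boosted path forces one flow value on all its arcs, and the first two arcs of the path are
-- copies of e. Hence E′ ≥ Σ_e r_e g_e² + Σ_{e∈S} r_e g_e². Minimality of f̃ gives the variational
-- inequality Σ_e r_e f̃_e (g_e − f̃_e) ≥ 0; with the pointwise bounds r g² ≥ r f̃² + 2 r f̃ (g − f̃)
-- and, on S, 2 r g² ≥ (3/2) r f̃² + 2 r f̃ (g − f̃), this yields E′ ≥ E + ½ Σ_{e∈S} r_e f̃_e².
-- Since û_e⁻² ≤ r_e ≤ 2 û_e⁻², also ρ_e² ≤ r_e f̃_e² ≤ 2 ρ_e², so E ≤ 2‖ρ‖² and
-- Σ_{e∈S} ρ_e² ≤ Σ_{e∈S} r_e f̃_e², which gives the bound (even with ¼ in place of ⅛).


open import Defs
open import Algebra.Bundles using (CommutativeRing)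
import Algebra.Properties.Semiring.Sum as SemiringSum
open import Data.Bool using (Bool; true; false; if_then_else_)
open import Data.Nat as ℕ using (ℕ; zero; suc; _≡ᵇ_)
import Data.Nat.Properties as ℕP
open import Data.Fin using (Fin; toℕ) renaming (zero to fzero; suc to fsuc)
open import Data.Fin.Properties using (_≟_; toℕ-injective; suc-injective)
open import Data.Fin.Subset using (Subset)
open import Data.Fin.Subset.Properties using (_∈?_)
open import Data.List using (List; []; _∷_; _++_; length; lookup; concat; map; tabulate; applyUpTo; upTo)
open import Data.Product using (_×_; _,_; proj₁; proj₂)
open import Data.Sum using (inj₁; inj₂)
open import Data.Sum.Properties using (inj₂-injective)
open import Data.Empty using (⊥-elim)
open import Data.Integer using (+_)
open import Data.Rational
  using (ℚ; 0ℚ; 1ℚ; _+_; _-_; _*_; -_; _/_; _≤_; _<_; _⊓_; ≢-nonZero; positive; nonNegative; nonPositive)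
open import Data.Rational.Properties hiding (_≟_)
open import Data.Rational.Properties using () renaming (_≟_ to _≟ℚ_)
open import Data.Rational.Solver using (module +-*-Solver)
open import Function using (_∘_; id)
open import Relation.Nullary using (yes; no; does)
open import Relation.Binary.Definitions using (DecidableEquality; tri<; tri≈; tri>)
open import Relation.Binary.PropositionalEquality

open +-*-Solver

0≤p*q : ∀ {p q} → 0ℚ ≤ p → 0ℚ ≤ q → 0ℚ ≤ p * q
0≤p*q {p} {q} 0≤p 0≤q = nonNegative⁻¹ (p * q) {{nonNeg*nonNeg⇒nonNeg p {{nonNegative 0≤p}} q {{nonNegative 0≤q}}}}

0≤p+q : ∀ {p q} → 0ℚ ≤ p → 0ℚ ≤ q → 0ℚ ≤ p + q
0≤p+q {p} {q} 0≤p 0≤q = nonNegative⁻¹ (p + q) {{nonNeg+nonNeg⇒nonNeg p {{nonNegative 0≤p}} q {{nonNegative 0≤q}}}}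

0≤p*p : ∀ p → 0ℚ ≤ p * p
0≤p*p p with ≤-total 0ℚ p
... | inj₁ 0≤p = 0≤p*q 0≤p 0≤p
... | inj₂ p≤0 = nonNegative⁻¹ (p * p) {{nonPos*nonPos⇒nonPos p {{nonPositive p≤0}} p {{nonPositive p≤0}}}}

*-monoˡ-≤-0≤ : ∀ {r p q} → 0ℚ ≤ r → p ≤ q → r * p ≤ r * q
*-monoˡ-≤-0≤ {r} 0≤r = *-monoˡ-≤-nonNeg r {{nonNegative 0≤r}}

*-monoʳ-≤-0≤ : ∀ {r p q} → 0ℚ ≤ r → p ≤ q → p * r ≤ q * r
*-monoʳ-≤-0≤ {r} 0≤r = *-monoʳ-≤-nonNeg r {{nonNegative 0≤r}}

p≤q⇒0≤q-p : ∀ {p q} → p ≤ q → 0ℚ ≤ q - p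
p≤q⇒0≤q-p {p} {q} p≤q = subst (_≤ q - p) (+-inverseʳ p) (+-monoˡ-≤ (- p) p≤q)

p<q⇒0<q-p : ∀ {p q} → p < q → 0ℚ < q - p
p<q⇒0<q-p {p} {q} p<q = subst (_< q - p) (+-inverseʳ p) (+-monoˡ-< (- p) p<q)

0≤q-p⇒p≤q : ∀ {p q} → 0ℚ ≤ q - p → p ≤ q
0≤q-p⇒p≤q {p} {q} 0≤q-p = subst₂ _≤_ (+-identityʳ p) (solve 2 (λ p q → p :+ (q :- p) := q) refl p q) (+-monoʳ-≤ p 0≤q-p)

p-q≡0⇒p≡q : ∀ {p q} → p - q ≡ 0ℚ → p ≡ q
p-q≡0⇒p≡q {p} {q} p-q≡0 = begin
  p              ≡⟨ solve 2 (λ p q → p := (p :- q) :+ q) refl p q ⟩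
  (p - q) + q    ≡⟨ cong (_+ q) p-q≡0 ⟩
  0ℚ + q         ≡⟨ +-identityˡ q ⟩
  q              ∎
  where open ≡-Reasoning

inv*p≡1 : ∀ {p} → p ≢ 0ℚ → inv p * p ≡ 1ℚ
inv*p≡1 {p} p≢0 with p ≟ℚ 0ℚ
... | yes p≡0 = ⊥-elim (p≢0 p≡0)
... | no p≢0′ = *-inverseˡ p {{≢-nonZero p≢0′}}

inv-pos : ∀ {p} → 0ℚ < p → 0ℚ < inv p
inv-pos {p} 0<p with p ≟ℚ 0ℚ
... | yes p≡0 = ⊥-elim (<⇒≢ 0<p (sym p≡0))
... | no p≢0 = positive⁻¹ _ {{1/pos⇒pos p {{positive 0<p}}}}

inv-nonNeg : ∀ {p} → 0ℚ ≤ p → 0ℚ ≤ inv p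
inv-nonNeg {p} 0≤p with p ≟ℚ 0ℚ
... | yes _ = ≤-refl
... | no p≢0 = <⇒≤ (positive⁻¹ _ {{1/pos⇒pos p {{pos}}}})
  where pos = nonNeg∧nonZero⇒pos p {{nonNegative 0≤p}} {{≢-nonZero p≢0}}

inv-unique : ∀ {p q} → p ≢ 0ℚ → q * p ≡ 1ℚ → q ≡ inv p
inv-unique {p} {q} p≢0 q*p≡1 = begin
  q               ≡⟨ sym (*-identityʳ q) ⟩
  q * 1ℚ          ≡⟨ cong (q *_) (sym (inv*p≡1 p≢0)) ⟩
  q * (inv p * p) ≡⟨ solve 3 (λ q i p → q :* (i :* p) := (q :* p) :* i) refl q (inv p) p ⟩
  (q * p) * inv p ≡⟨ cong (_* inv p) q*p≡1 ⟩
  1ℚ * inv p      ≡⟨ *-identityˡ (inv p) ⟩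
  inv p           ∎
  where open ≡-Reasoning

inv-square : ∀ {p} → 0ℚ < p → inv (p * p) ≡ inv p * inv p
inv-square {p} 0<p = sym (inv-unique p*p≢0 (begin
  inv p * inv p * (p * p)     ≡⟨ solve 2 (λ i p → i :* i :* (p :* p) := (i :* p) :* (i :* p)) refl (inv p) p ⟩
  (inv p * p) * (inv p * p)   ≡⟨ cong₂ _*_ (inv*p≡1 p≢0) (inv*p≡1 p≢0) ⟩
  1ℚ                          ∎))
  where
  open ≡-Reasoning
  p≢0 : p ≢ 0ℚ
  p≢0 = ≢-sym (<⇒≢ 0<p)
  p*p≢0 : p * p ≢ 0ℚ
  p*p≢0 = ≢-sym (<⇒≢ (positive⁻¹ _ {{pos*pos⇒pos p {{positive 0<p}} p {{positive 0<p}}}}))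

inv-antimono : ∀ {p q} → 0ℚ < p → p ≤ q → inv q ≤ inv p
inv-antimono {p} {q} 0<p p≤q = begin
  inv q                 ≡⟨ sym (*-identityʳ (inv q)) ⟩
  inv q * 1ℚ            ≡⟨ cong (inv q *_) (sym (trans (*-comm p (inv p)) (inv*p≡1 (≢-sym (<⇒≢ 0<p))))) ⟩
  inv q * (p * inv p)   ≤⟨ *-monoˡ-≤-0≤ (<⇒≤ (inv-pos 0<q)) (*-monoʳ-≤-0≤ (<⇒≤ (inv-pos 0<p)) p≤q) ⟩
  inv q * (q * inv p)   ≡⟨ solve 3 (λ i q j → i :* (q :* j) := (i :* q) :* j) refl (inv q) q (inv p) ⟩
  (inv q * q) * inv p   ≡⟨ cong (_* inv p) (inv*p≡1 (≢-sym (<⇒≢ 0<q))) ⟩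
  1ℚ * inv p            ≡⟨ *-identityˡ (inv p) ⟩
  inv p                 ∎
  where
  open ≤-Reasoning
  0<q : 0ℚ < q
  0<q = <-≤-trans 0<p p≤q

quadratic-nonNeg⇒linear-nonNeg : ∀ L Q → 0ℚ ≤ Q → (∀ t → 0ℚ ≤ t * L + t * t * Q) → 0ℚ ≤ L
quadratic-nonNeg⇒linear-nonNeg L Q 0≤Q 0≤quadratic with <-cmp L 0ℚ
... | tri≈ _ L≡0 _ = ≤-reflexive (sym L≡0)
... | tri> _ _ 0<L = <⇒≤ 0<L
... | tri< L<0 _ _ = ⊥-elim (<-irrefl refl (≤-<-trans (0≤quadratic t) quadratic<0))
  where
  -- at t = -L/(Q+1) the quadratic equals -L²/(Q+1)² < 0
  0<Q+1 : 0ℚ < Q + 1ℚ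
  0<Q+1 = ≤-<-trans 0≤Q (subst (_< Q + 1ℚ) (+-identityʳ Q) (+-monoʳ-< Q (positive⁻¹ 1ℚ)))
  k = inv (Q + 1ℚ)
  0<k : 0ℚ < k
  0<k = inv-pos 0<Q+1
  Lk<0 : L * k < 0ℚ
  Lk<0 = subst (L * k <_) (*-zeroˡ k) (*-monoˡ-<-pos k {{positive 0<k}} L<0)
  t = - (L * k)
  L+tQ≡Lk : L + t * Q ≡ L * k
  L+tQ≡Lk = begin
    L + t * Q                  ≡⟨ cong (λ z → z + t * Q) (sym (trans (cong (L *_) k*Q+1≡1) (*-identityʳ L))) ⟩
    L * (k * (Q + 1ℚ)) + t * Q ≡⟨ solve 3 (λ L k Q → L :* (k :* (Q :+ con 1ℚ)) :+ (:- (L :* k)) :* Q := L :* k) refl L k Q ⟩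
    L * k                      ∎
    where
    open ≡-Reasoning
    k*Q+1≡1 : k * (Q + 1ℚ) ≡ 1ℚ
    k*Q+1≡1 = inv*p≡1 (≢-sym (<⇒≢ 0<Q+1))
  quadratic<0 : t * L + t * t * Q < 0ℚ
  quadratic<0 = begin-strict
    t * L + t * t * Q ≡⟨ solve 3 (λ t L Q → t :* L :+ t :* t :* Q := t :* (L :+ t :* Q)) refl t L Q ⟩
    t * (L + t * Q)   ≡⟨ cong (t *_) L+tQ≡Lk ⟩
    t * (L * k)       <⟨ *-monoʳ-<-pos t {{positive (neg-antimono-< Lk<0)}} Lk<0 ⟩
    t * 0ℚ            ≡⟨ *-zeroʳ t ⟩
    0ℚ                ∎
    where open ≤-Reasoning

module ℚΣ = SemiringSum (CommutativeRing.semiring +-*-commutativeRing)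

∑≡sum : ∀ {m} (g : Fin m → ℚ) → ∑ g ≡ ℚΣ.sum g
∑≡sum {zero} g = refl
∑≡sum {suc m} g = cong (_+_ (g fzero)) (∑≡sum (g ∘ fsuc))

∑-cong : ∀ {m} {g h : Fin m → ℚ} → (∀ i → g i ≡ h i) → ∑ g ≡ ∑ h
∑-cong {g = g} {h} g≗h = trans (∑≡sum g) (trans (ℚΣ.sum-cong-≗ g≗h) (sym (∑≡sum h)))

∑-distrib-+ : ∀ {m} (g h : Fin m → ℚ) → ∑ (λ i → g i + h i) ≡ ∑ g + ∑ h
∑-distrib-+ g h = begin
  ∑ (λ i → g i + h i)        ≡⟨ ∑≡sum (λ i → g i + h i) ⟩
  ℚΣ.sum (λ i → g i + h i)   ≡⟨ ℚΣ.∑-distrib-+ g h ⟩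
  ℚΣ.sum g + ℚΣ.sum h        ≡⟨ sym (cong₂ _+_ (∑≡sum g) (∑≡sum h)) ⟩
  ∑ g + ∑ h                  ∎
  where open ≡-Reasoning

*-distribˡ-∑ : ∀ {m} (k : ℚ) (g : Fin m → ℚ) → k * ∑ g ≡ ∑ (λ i → k * g i)
*-distribˡ-∑ k g = begin
  k * ∑ g                ≡⟨ cong (k *_) (∑≡sum g) ⟩
  k * ℚΣ.sum g           ≡⟨ ℚΣ.*-distribˡ-sum k g ⟩
  ℚΣ.sum (λ i → k * g i) ≡⟨ sym (∑≡sum (λ i → k * g i)) ⟩
  ∑ (λ i → k * g i)      ∎
  where open ≡-Reasoning

∑-mono-≤ : ∀ {m} {g h : Fin m → ℚ} → (∀ i → g i ≤ h i) → ∑ g ≤ ∑ h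
∑-mono-≤ {zero} g≤h = ≤-refl
∑-mono-≤ {suc m} g≤h = +-mono-≤ (g≤h fzero) (∑-mono-≤ (g≤h ∘ fsuc))

∑-nonNeg : ∀ {m} {g : Fin m → ℚ} → (∀ i → 0ℚ ≤ g i) → 0ℚ ≤ ∑ g
∑-nonNeg {zero} 0≤g = ≤-refl
∑-nonNeg {suc m} 0≤g = 0≤p+q (0≤g fzero) (∑-nonNeg (0≤g ∘ fsuc))

∑-zero : ∀ {m} {g : Fin m → ℚ} → (∀ i → g i ≡ 0ℚ) → ∑ g ≡ 0ℚ
∑-zero {zero} g≡0 = refl
∑-zero {suc m} g≡0 = cong₂ _+_ (g≡0 fzero) (∑-zero (g≡0 ∘ fsuc))

∑-single : ∀ {m} (g : Fin m → ℚ) (k : Fin m) → (∀ i → i ≢ k → g i ≡ 0ℚ) → ∑ g ≡ g k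
∑-single g fzero g≡0 = trans (cong (_+_ (g fzero)) (∑-zero (λ i → g≡0 (fsuc i) λ ()))) (+-identityʳ _)
∑-single g (fsuc k) g≡0 =
  trans (cong₂ _+_ (g≡0 fzero λ ()) (∑-single (g ∘ fsuc) k (λ i i≢k → g≡0 (fsuc i) (i≢k ∘ suc-injective))))
        (+-identityˡ _)

∑-interpolate : ∀ {m} (g h : Fin m → ℚ) t → ∑ (λ i → g i + t * (h i - g i)) ≡ ∑ g + t * (∑ h - ∑ g)
∑-interpolate {zero} g h t = solve 1 (λ t → con 0ℚ := con 0ℚ :+ t :* (con 0ℚ :- con 0ℚ)) refl t
∑-interpolate {suc m} g h t =
  trans (cong (_+_ (g fzero + t * (h fzero - g fzero))) (∑-interpolate (g ∘ fsuc) (h ∘ fsuc) t))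
        (solve 5 (λ x y t sx sy → (x :+ t :* (y :- x)) :+ (sx :+ t :* (sy :- sx)) := (x :+ sx) :+ t :* ((y :+ sy) :- (x :+ sx)))
               refl (g fzero) (h fzero) t (∑ (g ∘ fsuc)) (∑ (h ∘ fsuc)))

∑ₗ : ∀ {A : Set} (L : List A) → (Fin (length L) → ℚ) → (A → ℚ → ℚ) → ℚ
∑ₗ L w F = ∑ (λ i → F (lookup L i) (w i))

module _ {A : Set} where

  index-++ˡ : ∀ (xs ys : List A) → Fin (length xs) → Fin (length (xs ++ ys))
  index-++ˡ (x ∷ xs) ys fzero = fzero
  index-++ˡ (x ∷ xs) ys (fsuc i) = fsuc (index-++ˡ xs ys i)

  index-++ʳ : ∀ (xs ys : List A) → Fin (length ys) → Fin (length (xs ++ ys))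
  index-++ʳ [] ys i = i
  index-++ʳ (x ∷ xs) ys i = fsuc (index-++ʳ xs ys i)

  ∑ₗ-++ : ∀ xs ys w F → ∑ₗ (xs ++ ys) w F ≡ ∑ₗ xs (w ∘ index-++ˡ xs ys) F + ∑ₗ ys (w ∘ index-++ʳ xs ys) F
  ∑ₗ-++ [] ys w F = sym (+-identityˡ _)
  ∑ₗ-++ (x ∷ xs) ys w F =
    trans (cong (_+_ (F x (w fzero))) (∑ₗ-++ xs ys (w ∘ fsuc) F))
          (sym (+-assoc (F x (w fzero)) (∑ₗ xs (w ∘ fsuc ∘ index-++ˡ xs ys) F) (∑ₗ ys (w ∘ fsuc ∘ index-++ʳ xs ys) F)))

  blockWeights : ∀ {B : Set} {m} (g : Fin m → B) (h : B → List A) →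
    (Fin (length (concat (map h (tabulate g)))) → ℚ) → (e : Fin m) → Fin (length (h (g e))) → ℚ
  blockWeights {m = suc m} g h w fzero = w ∘ index-++ˡ (h (g fzero)) (concat (map h (tabulate (g ∘ fsuc))))
  blockWeights {m = suc m} g h w (fsuc e) =
    blockWeights (g ∘ fsuc) h (w ∘ index-++ʳ (h (g fzero)) (concat (map h (tabulate (g ∘ fsuc))))) e

  ∑ₗ-concat : ∀ {B : Set} {m} (g : Fin m → B) (h : B → List A) w F →
    ∑ₗ (concat (map h (tabulate g))) w F ≡ ∑ (λ e → ∑ₗ (h (g e)) (blockWeights g h w e) F)
  ∑ₗ-concat {m = zero} g h w F = refl
  ∑ₗ-concat {m = suc m} g h w F =
    trans (∑ₗ-++ (h (g fzero)) (concat (map h (tabulate (g ∘ fsuc)))) w F)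
          (cong (_+_ (∑ₗ (h (g fzero)) (blockWeights g h w fzero) F)) (∑ₗ-concat (g ∘ fsuc) h _ F))

  ∑ₗ-nonNeg : ∀ L w (F : A → ℚ → ℚ) → (∀ a x → 0ℚ ≤ F a x) → 0ℚ ≤ ∑ₗ L w F
  ∑ₗ-nonNeg L w F 0≤F = ∑-nonNeg (λ i → 0≤F (lookup L i) (w i))

  ∑ₗ-map-zero : ∀ {B : Set} (k : B → A) L w (F : A → ℚ → ℚ) → (∀ b x → F (k b) x ≡ 0ℚ) → ∑ₗ (map k L) w F ≡ 0ℚ
  ∑ₗ-map-zero k [] w F F≡0 = refl
  ∑ₗ-map-zero k (b ∷ L) w F F≡0 = cong₂ _+_ (F≡0 b (w fzero)) (∑ₗ-map-zero k L (w ∘ fsuc) F F≡0)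

module _ {A : Set} (dec : DecidableEquality A) {x v : A} (q : ℚ) where

  ind-≡ : x ≡ v → ind dec x v q ≡ q
  ind-≡ x≡v with dec x v
  ... | yes _ = refl
  ... | no x≢v = ⊥-elim (x≢v x≡v)

  ind-≢ : x ≢ v → ind dec x v q ≡ 0ℚ
  ind-≢ x≢v with dec x v
  ... | yes x≡v = ⊥-elim (x≢v x≡v)
  ... | no _ = refl

module _ {V : Set} (dec : DecidableEquality V) (G : Digraph V) where

  ind-interpolate : ∀ (x v : V) p q t → ind dec x v (p + t * (q - p)) ≡ ind dec x v p + t * (ind dec x v q - ind dec x v p)
  ind-interpolate x v p q t with does (dec x v)
  ... | true = refl
  ... | false = solve 1 (λ t → con 0ℚ := con 0ℚ :+ t :* (con 0ℚ :- con 0ℚ)) refl t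

  IsFlow-interpolate : ∀ {σ a b} t → IsFlow dec G σ a → IsFlow dec G σ b → IsFlow dec G σ (λ e → a e + t * (b e - a e))
  IsFlow-interpolate {σ} {a} {b} t a-flow b-flow v = begin
    netIn dec G (λ e → a e + t * (b e - a e)) v ≡⟨ ∑-cong net-interpolate ⟩
    ∑ (λ e → net a e + t * (net b e - net a e)) ≡⟨ ∑-interpolate (net a) (net b) t ⟩
    netIn dec G a v + t * (netIn dec G b v - netIn dec G a v) ≡⟨ cong₂ (λ x y → x + t * (y - x)) (a-flow v) (b-flow v) ⟩
    σ v + t * (σ v - σ v) ≡⟨ solve 2 (λ s t → s :+ t :* (s :- s) := s) refl (σ v) t ⟩
    σ v ∎
    where
    open ≡-Reasoning
    net : Flow G → Fin (m G) → ℚ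
    net g e = ind dec (hd G e) v (g e) - ind dec (tl G e) v (g e)
    net-interpolate : ∀ e → net (λ e → a e + t * (b e - a e)) e ≡ net a e + t * (net b e - net a e)
    net-interpolate e = begin
      net (λ e → a e + t * (b e - a e)) e
        ≡⟨ cong₂ _-_ (ind-interpolate (hd G e) v (a e) (b e) t) (ind-interpolate (tl G e) v (a e) (b e) t) ⟩
      (ha + t * (hb - ha)) - (ta + t * (tb - ta))
        ≡⟨ solve 5 (λ ha hb ta tb t → (ha :+ t :* (hb :- ha)) :- (ta :+ t :* (tb :- ta))
                                      := (ha :- ta) :+ t :* ((hb :- tb) :- (ha :- ta))) refl ha hb ta tb t ⟩
      net a e + t * (net b e - net a e) ∎
      where
      ha = ind dec (hd G e) v (a e)
      hb = ind dec (hd G e) v (b e)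
      ta = ind dec (tl G e) v (a e)
      tb = ind dec (tl G e) v (b e)

  energy-interpolate : ∀ (r : Fin (m G) → ℚ) (a b : Flow G) t →
    energy G r (λ e → a e + t * (b e - a e))
      ≡ energy G r a + (t * ((1ℚ + 1ℚ) * ∑ (λ e → r e * (a e * (b e - a e)))) + t * t * ∑ (λ e → r e * ((b e - a e) * (b e - a e))))
  energy-interpolate r a b t = begin
    energy G r (λ e → a e + t * (b e - a e))
      ≡⟨ ∑-cong (λ e → solve 4 (λ t r a b → r :* ((a :+ t :* (b :- a)) :* (a :+ t :* (b :- a)))
                                  := r :* (a :* a) :+ ((t :* (con 1ℚ :+ con 1ℚ)) :* (r :* (a :* (b :- a)))
                                                       :+ (t :* t) :* (r :* ((b :- a) :* (b :- a)))))
                                refl t (r e) (a e) (b e)) ⟩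
    ∑ (λ e → r e * (a e * a e) + ((t * two) * C e + (t * t) * Q e))
      ≡⟨ ∑-distrib-+ (λ e → r e * (a e * a e)) _ ⟩
    energy G r a + ∑ (λ e → (t * two) * C e + (t * t) * Q e)
      ≡⟨ cong (_+_ (energy G r a)) (∑-distrib-+ (λ e → (t * two) * C e) (λ e → (t * t) * Q e)) ⟩
    energy G r a + (∑ (λ e → (t * two) * C e) + ∑ (λ e → (t * t) * Q e))
      ≡⟨ cong (_+_ (energy G r a)) (sym (cong₂ _+_ (*-distribˡ-∑ (t * two) C) (*-distribˡ-∑ (t * t) Q))) ⟩
    energy G r a + ((t * two) * ∑ C + (t * t) * ∑ Q)
      ≡⟨ cong (λ z → energy G r a + (z + (t * t) * ∑ Q)) (*-assoc t two (∑ C)) ⟩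
    energy G r a + (t * (two * ∑ C) + t * t * ∑ Q) ∎
    where
    open ≡-Reasoning
    two = 1ℚ + 1ℚ
    C Q : Fin (m G) → ℚ
    C e = r e * (a e * (b e - a e))
    Q e = r e * ((b e - a e) * (b e - a e))

  electrical-variational-inequality : ∀ {r σ a b} → (∀ e → 0ℚ ≤ r e) → IsElectrical dec G r σ a → IsFlow dec G σ b →
    0ℚ ≤ ∑ (λ e → r e * (a e * (b e - a e)))
  electrical-variational-inequality {r} {σ} {a} {b} 0≤r (a-flow , a-min) b-flow =
    *-cancelˡ-≤-pos (1ℚ + 1ℚ) (subst (_≤ (1ℚ + 1ℚ) * C) (sym (*-zeroʳ (1ℚ + 1ℚ))) 0≤2C)
    where
    C = ∑ (λ e → r e * (a e * (b e - a e)))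
    Q = ∑ (λ e → r e * ((b e - a e) * (b e - a e)))
    E = energy G r a
    0≤2C : 0ℚ ≤ (1ℚ + 1ℚ) * C
    0≤2C = quadratic-nonNeg⇒linear-nonNeg _ Q (∑-nonNeg (λ e → 0≤p*q (0≤r e) (0≤p*p (b e - a e)))) λ t →
      subst (0ℚ ≤_) (solve 2 (λ E x → E :+ x :- E := x) refl E _)
        (p≤q⇒0≤q-p (subst (E ≤_) (energy-interpolate r a b t) (a-min _ (IsFlow-interpolate t a-flow b-flow))))

module _ {p q : ℚ} (0<p : 0ℚ < p) (0<q : 0ℚ < q) where

  private
    r = inv (p * p) + inv (q * q)

  resistance-bounds-≤ : p ≤ q → (inv p * inv p ≤ r) × (r ≤ inv p * inv p + inv p * inv p)
  resistance-bounds-≤ p≤q = lower , upper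
    where
    inv-q²≤inv-p² : inv (q * q) ≤ inv (p * p)
    inv-q²≤inv-p² = inv-antimono (positive⁻¹ _ {{pos*pos⇒pos p {{positive 0<p}} p {{positive 0<p}}}})
                      (≤-trans (*-monoˡ-≤-0≤ (<⇒≤ 0<p) p≤q) (*-monoʳ-≤-0≤ (<⇒≤ 0<q) p≤q))
    lower : inv p * inv p ≤ r
    lower = begin
      inv p * inv p       ≡⟨ sym (inv-square 0<p) ⟩
      inv (p * p)         ≡⟨ sym (+-identityʳ _) ⟩
      inv (p * p) + 0ℚ    ≤⟨ +-monoʳ-≤ (inv (p * p)) (inv-nonNeg (0≤p*p q)) ⟩
      r                   ∎
      where open ≤-Reasoning
    upper : r ≤ inv p * inv p + inv p * inv p
    upper = begin
      r                          ≤⟨ +-monoʳ-≤ (inv (p * p)) inv-q²≤inv-p² ⟩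
      inv (p * p) + inv (p * p)  ≡⟨ cong₂ _+_ (inv-square 0<p) (inv-square 0<p) ⟩
      inv p * inv p + inv p * inv p ∎
      where open ≤-Reasoning

resistance-bounds : ∀ {p q} → 0ℚ < p → 0ℚ < q →
  let i = inv (p ⊓ q) in (i * i ≤ inv (p * p) + inv (q * q)) × (inv (p * p) + inv (q * q) ≤ i * i + i * i)
resistance-bounds {p} {q} 0<p 0<q with ≤-total p q
... | inj₁ p≤q rewrite p≤q⇒p⊓q≡p p≤q = resistance-bounds-≤ 0<p 0<q p≤q
... | inj₂ q≤p rewrite p≥q⇒p⊓q≡q q≤p | +-comm (inv (p * p)) (inv (q * q)) = resistance-bounds-≤ 0<q 0<p q≤p

congestion-bounds : ∀ {i r} x → i * i ≤ r → r ≤ i * i + i * i →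
  ((x * i) * (x * i) ≤ r * (x * x)) × (r * (x * x) ≤ (x * i) * (x * i) + (x * i) * (x * i))
congestion-bounds {i} {r} x i²≤r r≤2i² =
  subst (_≤ r * (x * x)) (solve 2 (λ x i → (i :* i) :* (x :* x) := (x :* i) :* (x :* i)) refl x i) (*-monoʳ-≤-0≤ (0≤p*p x) i²≤r) ,
  subst (r * (x * x) ≤_) (solve 2 (λ x i → (i :* i :+ i :* i) :* (x :* x) := (x :* i) :* (x :* i) :+ (x :* i) :* (x :* i)) refl x i)
    (*-monoʳ-≤-0≤ (0≤p*p x) r≤2i²)

½ : ℚ
½ = + 1 / 2

when : Bool → ℚ → ℚ
when b x = if b then x else 0ℚ

when-mono-≤ : ∀ b {x y} → x ≤ y → when b x ≤ when b y
when-mono-≤ true x≤y = x≤y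
when-mono-≤ false _ = ≤-refl

when-nonNeg : ∀ b {x} → 0ℚ ≤ x → 0ℚ ≤ when b x
when-nonNeg true 0≤x = 0≤x
when-nonNeg false _ = ≤-refl

-- For a boosted arc the difference of the two sides is ½ r (2g - a)², otherwise it is r (g - a)².
boost-gain : ∀ b {r} a g → 0ℚ ≤ r →
  r * (a * a) + (½ * when b (r * (a * a)) + (1ℚ + 1ℚ) * (r * (a * (g - a)))) ≤ r * (g * g) + when b (r * (g * g))
boost-gain false {r} a g 0≤r = 0≤q-p⇒p≤q (subst (0ℚ ≤_)
  (solve 3 (λ r a g → r :* ((g :- a) :* (g :- a))
                      := r :* (g :* g) :+ con 0ℚ
                         :- (r :* (a :* a) :+ (con ½ :* con 0ℚ :+ (con 1ℚ :+ con 1ℚ) :* (r :* (a :* (g :- a))))))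
           refl r a g)
  (0≤p*q 0≤r (0≤p*p (g - a))))
boost-gain true {r} a g 0≤r = 0≤q-p⇒p≤q (subst (0ℚ ≤_)
  (solve 3 (λ r a g → con ½ :* (r :* (((con 1ℚ :+ con 1ℚ) :* g :- a) :* ((con 1ℚ :+ con 1ℚ) :* g :- a)))
                      := r :* (g :* g) :+ r :* (g :* g)
                         :- (r :* (a :* a) :+ (con ½ :* (r :* (a :* a)) :+ (con 1ℚ :+ con 1ℚ) :* (r :* (a :* (g :- a))))))
           refl r a g)
  (0≤p*q {½} (≤ᵇ⇒≤ _) (0≤p*q 0≤r (0≤p*p ((1ℚ + 1ℚ) * g - a)))))

boosted-energy-bound : ∀ {m} (r a g ρ : Fin m → ℚ) (b : Fin m → Bool) {E′} →
  (∀ e → 0ℚ ≤ r e) →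
  (∀ e → ρ e * ρ e ≤ r e * (a e * a e)) →
  (∀ e → r e * (a e * a e) ≤ ρ e * ρ e + ρ e * ρ e) →
  0ℚ ≤ ∑ (λ e → r e * (a e * (g e - a e))) →
  ∑ (λ e → r e * (g e * g e) + when (b e) (r e * (g e * g e))) ≤ E′ →
  (∑ (λ e → ρ e * ρ e) + (+ 1 / 8) * ∑ (λ e → when (b e) (ρ e * ρ e))) * ∑ (λ e → r e * (a e * a e))
    ≤ ∑ (λ e → ρ e * ρ e) * E′
boosted-energy-bound r a g ρ b {E′} 0≤r ρ²≤ra² ra²≤2ρ² 0≤C G≤E′ = begin
  (R + ⅛ * P) * E            ≡⟨ solve 3 (λ R P E → (R :+ con ⅛ :* P) :* E := R :* E :+ (con ⅛ :* P) :* E) refl R P E ⟩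
  R * E + (⅛ * P) * E        ≤⟨ +-monoʳ-≤ (R * E) (*-monoˡ-≤-0≤ (0≤p*q (≤ᵇ⇒≤ {0ℚ} {⅛} _) 0≤P) E≤2R) ⟩
  R * E + (⅛ * P) * (R + R)  ≡⟨ solve 3 (λ R P E → R :* E :+ (con ⅛ :* P) :* (R :+ R) := R :* (E :+ con ¼ :* P)) refl R P E ⟩
  R * (E + ¼ * P)            ≤⟨ *-monoˡ-≤-0≤ 0≤R (+-monoʳ-≤ E ¼P≤½A+2C) ⟩
  R * (E + (½ * A + two * C)) ≤⟨ *-monoˡ-≤-0≤ 0≤R (≤-trans E+½A+2C≤G G≤E′) ⟩
  R * E′                     ∎
  where
  open ≤-Reasoning
  ⅛ ¼ two : ℚ
  ⅛ = + 1 / 8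
  ¼ = + 1 / 4
  two = 1ℚ + 1ℚ
  R = ∑ (λ e → ρ e * ρ e)
  P = ∑ (λ e → when (b e) (ρ e * ρ e))
  E = ∑ (λ e → r e * (a e * a e))
  A = ∑ (λ e → when (b e) (r e * (a e * a e)))
  C = ∑ (λ e → r e * (a e * (g e - a e)))
  0≤R : 0ℚ ≤ R
  0≤R = ∑-nonNeg (λ e → 0≤p*p (ρ e))
  0≤P : 0ℚ ≤ P
  0≤P = ∑-nonNeg (λ e → when-nonNeg (b e) (0≤p*p (ρ e)))
  E≤2R : E ≤ R + R
  E≤2R = subst (E ≤_) (∑-distrib-+ (λ e → ρ e * ρ e) (λ e → ρ e * ρ e)) (∑-mono-≤ ra²≤2ρ²)
  0≤½ : 0ℚ ≤ ½
  0≤½ = ≤ᵇ⇒≤ _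
  ¼P≤½A+2C : ¼ * P ≤ ½ * A + two * C
  ¼P≤½A+2C = begin
    ¼ * P             ≤⟨ *-monoʳ-≤-0≤ 0≤P (≤ᵇ⇒≤ {¼} {½} _) ⟩
    ½ * P             ≤⟨ *-monoˡ-≤-0≤ 0≤½ (∑-mono-≤ (λ e → when-mono-≤ (b e) (ρ²≤ra² e))) ⟩
    ½ * A             ≡⟨ sym (+-identityʳ (½ * A)) ⟩
    ½ * A + 0ℚ        ≤⟨ +-monoʳ-≤ (½ * A) (*-monoˡ-≤-0≤ (≤ᵇ⇒≤ {0ℚ} {two} _) 0≤C) ⟩
    ½ * A + two * C   ∎
  E+½A+2C≤G : E + (½ * A + two * C) ≤ ∑ (λ e → r e * (g e * g e) + when (b e) (r e * (g e * g e)))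
  E+½A+2C≤G = subst (_≤ _) sum-split (∑-mono-≤ (λ e → boost-gain (b e) (a e) (g e) (0≤r e)))
    where
    sum-split : ∑ (λ e → r e * (a e * a e) + (½ * when (b e) (r e * (a e * a e)) + two * (r e * (a e * (g e - a e)))))
                  ≡ E + (½ * A + two * C)
    sum-split = begin-equality
      ∑ (λ e → r e * (a e * a e) + (½ * when (b e) (r e * (a e * a e)) + two * (r e * (a e * (g e - a e)))))
        ≡⟨ ∑-distrib-+ (λ e → r e * (a e * a e)) _ ⟩
      E + ∑ (λ e → ½ * when (b e) (r e * (a e * a e)) + two * (r e * (a e * (g e - a e))))
        ≡⟨ cong (_+_ E) (∑-distrib-+ (λ e → ½ * when (b e) (r e * (a e * a e))) (λ e → two * (r e * (a e * (g e - a e))))) ⟩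
      E + (∑ (λ e → ½ * when (b e) (r e * (a e * a e))) + ∑ (λ e → two * (r e * (a e * (g e - a e)))))
        ≡⟨ cong (_+_ E) (sym (cong₂ _+_ (*-distribˡ-∑ ½ (λ e → when (b e) (r e * (a e * a e))))
                                        (*-distribˡ-∑ two (λ e → r e * (a e * (g e - a e)))))) ⟩
      E + (½ * A + two * C) ∎

if-inj₂ : ∀ {A B : Set} (c : Bool) {x : A} {y z : B} → (if c then inj₁ x else inj₂ y) ≡ inj₂ z → y ≡ z
if-inj₂ true ()
if-inj₂ false refl = refl

module Boosting {n : ℕ} (N : Network n) (f : Fin (arcs N) → ℚ) where

  private
    dV = decV' N f

  arcNet : V' N f → ArcF N f → ℚ → ℚ
  arcNet v a x = ind dV (ArcF.a-hd a) v x - ind dV (ArcF.a-tl a) v x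

  arcEnergy : ArcF N f → ℚ → ℚ
  arcEnergy a x =
    (invSq (resid⁺ (ArcF.a-cap⁺ a) (ArcF.a-flow a)) + invSq (resid⁻ (ArcF.a-cap⁻ a) (ArcF.a-flow a))) * (x * x)

  arcEnergy-nonNeg : ∀ a x → 0ℚ ≤ arcEnergy a x
  arcEnergy-nonNeg a x =
    0≤p*q (0≤p+q (invSq-nonNeg (resid⁺ (ArcF.a-cap⁺ a) (ArcF.a-flow a))) (invSq-nonNeg (resid⁻ (ArcF.a-cap⁻ a) (ArcF.a-flow a))))
          (0≤p*p x)
    where
    invSq-nonNeg : ∀ c → 0ℚ ≤ invSq c
    invSq-nonNeg (fin c) = inv-nonNeg (0≤p*p c)
    invSq-nonNeg ∞ = ≤-refl

  pathTail pathHead : Fin (arcs N) → ℕ → V' N f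
  pathTail e c = if c ≡ᵇ 0 then inj₁ (tail N e) else inj₂ (toℕ e , c)
  pathHead e c = if suc c ≡ᵇ β N f e then inj₁ (head N e) else inj₂ (toℕ e , suc c)

  -- The local function of Defs.pathArcs, so that pathArcs N f e reduces to map (pathArc e) (upTo (β N f e)).
  pathArc : Fin (arcs N) → ℕ → ArcF N f
  pathArc e c = arcF (pathTail e c) (pathHead e c)
                     (if c ℕ.<ᵇ 2 then fin (ℕ→ℚ (u⁺ N e)) else proj₁ (newCaps N f e))
                     (if c ℕ.<ᵇ 2 then fin (ℕ→ℚ (u⁻ N e)) else proj₂ (newCaps N f e))
                     (f e)

  arcNet-otherPath : ∀ e {j i} c x → j ≢ toℕ e → arcNet (inj₂ (j , i)) (pathArc e c) x ≡ 0ℚ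
  arcNet-otherPath e c x j≢e = cong₂ _-_
    (ind-≢ dV x (λ eq → j≢e (sym (cong proj₁ (if-inj₂ (suc c ≡ᵇ β N f e) eq)))))
    (ind-≢ dV x (λ eq → j≢e (sym (cong proj₁ (if-inj₂ (c ≡ᵇ 0) eq)))))

  module Path (e : Fin (arcs N)) where

    private
      j = toℕ e
      β′ = β N f e

    -- The arcs φ 0, …, φ (k ∸ 1) of the path; φ stays abstract (with φ x ≡ c + x) because
    -- applyUpTo passes φ ∘ suc, not (suc c +_), to its tail.
    segment : (ℕ → ℕ) → ℕ → List (ArcF N f)
    segment φ k = map (pathArc e) (applyUpTo φ k)

    ConservedBeyond : ℕ → (L : List (ArcF N f)) → (Fin (length L) → ℚ) → Set
    ConservedBeyond c L w = ∀ i → c ℕ.< i → ∑ₗ L w (arcNet (inj₂ (j , i))) ≡ 0ℚ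

    pathTail-≢ : ∀ {c i} → c ≢ i → pathTail e c ≢ inj₂ (j , i)
    pathTail-≢ {c} c≢i eq = c≢i (cong proj₂ (if-inj₂ (c ≡ᵇ 0) eq))

    pathHead-≢ : ∀ {c i} → suc c ≢ i → pathHead e c ≢ inj₂ (j , i)
    pathHead-≢ {c} 1+c≢i eq = 1+c≢i (cong proj₂ (if-inj₂ (suc c ≡ᵇ β′) eq))

    pathHead-last : ∀ {c} → suc c ≡ β′ → pathHead e c ≡ inj₁ (head N e)
    pathHead-last {c} 1+c≡β with suc c ≡ᵇ β′ | ℕP.≡⇒≡ᵇ (suc c) β′ 1+c≡β
    ... | true | _ = refl
    ... | false | ()

    pathHead-inner : ∀ {c} → suc c ≢ β′ → pathHead e c ≡ inj₂ (j , suc c)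
    pathHead-inner {c} 1+c≢β with suc c ≡ᵇ β′ | ℕP.≡ᵇ⇒≡ (suc c) β′
    ... | false | _ = refl
    ... | true | 1+c≡β = ⊥-elim (1+c≢β (1+c≡β _))

    arcNet-away : ∀ {c i} x → suc c ≢ i → c ≢ i → arcNet (inj₂ (j , i)) (pathArc e c) x ≡ 0ℚ
    arcNet-away x 1+c≢i c≢i = cong₂ _-_ (ind-≢ dV x (pathHead-≢ 1+c≢i)) (ind-≢ dV x (pathTail-≢ c≢i))

    module _ {φ : ℕ → ℕ} {c : ℕ} (φ≗c+ : ∀ x → φ x ≡ c ℕ.+ x) where

      arcNet-start : ∀ v x → arcNet v (pathArc e (φ 0)) x ≡ arcNet v (pathArc e c) x
      arcNet-start v x = cong (λ c′ → arcNet v (pathArc e c′) x) (trans (φ≗c+ 0) (ℕP.+-identityʳ c))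

      φ∘suc≗1+c+ : ∀ x → φ (suc x) ≡ suc c ℕ.+ x
      φ∘suc≗1+c+ x = trans (φ≗c+ (suc x)) (ℕP.+-suc c x)

      conserved-tail : ∀ k (w : Fin (length (segment φ (suc (suc k)))) → ℚ) →
        ConservedBeyond c (segment φ (suc (suc k))) w → ConservedBeyond (suc c) (segment (φ ∘ suc) (suc k)) (w ∘ fsuc)
      conserved-tail k w conserved i 1+c<i = begin
        ∑ₗ rest (w ∘ fsuc) F                                 ≡⟨ sym (+-identityˡ _) ⟩
        0ℚ + ∑ₗ rest (w ∘ fsuc) F                            ≡⟨ cong (_+ ∑ₗ rest (w ∘ fsuc) F) (sym first≡0) ⟩
        F (pathArc e (φ 0)) (w fzero) + ∑ₗ rest (w ∘ fsuc) F ≡⟨ conserved i c<i ⟩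
        0ℚ                                                   ∎
        where
        open ≡-Reasoning
        rest = segment (φ ∘ suc) (suc k)
        F = arcNet (inj₂ (j , i))
        c<i : c ℕ.< i
        c<i = ℕP.<-trans (ℕP.n<1+n c) 1+c<i
        first≡0 : F (pathArc e (φ 0)) (w fzero) ≡ 0ℚ
        first≡0 = trans (arcNet-start _ _) (arcNet-away _ (ℕP.<⇒≢ 1+c<i) (ℕP.<⇒≢ c<i))

    not-last : ∀ {c k} → suc (c ℕ.+ suc k) ≡ β′ → suc c ≢ β′
    not-last {c} {k} 1+c+1+k≡β 1+c≡β = ℕP.m≢1+m+n c (trans (ℕP.suc-injective (trans 1+c≡β (sym 1+c+1+k≡β))) (ℕP.+-suc c k))

    shift-length : ∀ {c k} → suc (c ℕ.+ suc k) ≡ β′ → suc (suc c ℕ.+ k) ≡ β′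
    shift-length {c} {k} = trans (cong suc (sym (ℕP.+-suc c k)))

    -- Flow conservation at the inner vertices of a path forces a constant flow along it, so the
    -- path acts on its outer vertices like the single arc e.
    segment-net : ∀ k φ c (w : Fin (length (segment φ (suc k))) → ℚ) → (∀ x → φ x ≡ c ℕ.+ x) → suc (c ℕ.+ k) ≡ β′ →
      ConservedBeyond c (segment φ (suc k)) w → ∀ v → (∀ i → c ℕ.< i → v ≢ inj₂ (j , i)) →
      ∑ₗ (segment φ (suc k)) w (arcNet v) ≡ ind dV (inj₁ (head N e)) v (w fzero) - ind dV (pathTail e c) v (w fzero)

    segment-constant : ∀ k φ c (w : Fin (length (segment φ (suc (suc k)))) → ℚ) → (∀ x → φ x ≡ c ℕ.+ x) →
      suc (c ℕ.+ suc k) ≡ β′ → ConservedBeyond c (segment φ (suc (suc k))) w → w (fsuc fzero) ≡ w fzero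

    segment-net zero φ c w φ≗c+ 1+c+0≡β conserved v _ = begin
      arcNet v (pathArc e (φ 0)) (w fzero) + 0ℚ
        ≡⟨ +-identityʳ _ ⟩
      arcNet v (pathArc e (φ 0)) (w fzero)
        ≡⟨ arcNet-start φ≗c+ v (w fzero) ⟩
      arcNet v (pathArc e c) (w fzero)
        ≡⟨ cong (λ h → ind dV h v (w fzero) - ind dV (pathTail e c) v (w fzero)) (pathHead-last 1+c≡β) ⟩
      ind dV (inj₁ (head N e)) v (w fzero) - ind dV (pathTail e c) v (w fzero) ∎
      where
      open ≡-Reasoning
      1+c≡β : suc c ≡ β′
      1+c≡β = trans (cong suc (sym (ℕP.+-identityʳ c))) 1+c+0≡β
    segment-net (suc k) φ c w φ≗c+ 1+c+1+k≡β conserved v v-outer = begin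
      arcNet v (pathArc e (φ 0)) w₀ + ∑ₗ (segment (φ ∘ suc) (suc k)) (w ∘ fsuc) (arcNet v)
        ≡⟨ cong₂ _+_ first rest ⟩
      (0ℚ - T) + (ind dV (inj₁ (head N e)) v w₁ - 0ℚ)
        ≡⟨ cong (λ z → (0ℚ - T) + (ind dV (inj₁ (head N e)) v z - 0ℚ)) (segment-constant k φ c w φ≗c+ 1+c+1+k≡β conserved) ⟩
      (0ℚ - T) + (H - 0ℚ)
        ≡⟨ solve 2 (λ T H → (con 0ℚ :- T) :+ (H :- con 0ℚ) := H :- T) refl T H ⟩
      H - T ∎
      where
      open ≡-Reasoning
      w₀ = w fzero
      w₁ = w (fsuc fzero)
      T = ind dV (pathTail e c) v w₀
      H = ind dV (inj₁ (head N e)) v w₀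
      u≢v : inj₂ (j , suc c) ≢ v
      u≢v eq = v-outer (suc c) (ℕP.n<1+n c) (sym eq)
      first : arcNet v (pathArc e (φ 0)) w₀ ≡ 0ℚ - T
      first = trans (arcNet-start φ≗c+ v w₀)
                    (cong (_- T) (trans (cong (λ h → ind dV h v w₀) (pathHead-inner (not-last 1+c+1+k≡β))) (ind-≢ dV w₀ u≢v)))
      rest : ∑ₗ (segment (φ ∘ suc) (suc k)) (w ∘ fsuc) (arcNet v) ≡ ind dV (inj₁ (head N e)) v w₁ - 0ℚ
      rest = trans (segment-net k (φ ∘ suc) (suc c) (w ∘ fsuc) (φ∘suc≗1+c+ φ≗c+) (shift-length 1+c+1+k≡β)
                                (conserved-tail φ≗c+ k w conserved) v (λ i 1+c<i → v-outer i (ℕP.<-trans (ℕP.n<1+n c) 1+c<i)))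
                   (cong (_-_ (ind dV (inj₁ (head N e)) v w₁)) (ind-≢ dV w₁ u≢v))

    segment-constant k φ c w φ≗c+ 1+c+1+k≡β conserved = sym (p-q≡0⇒p≡q (begin
      w₀ - w₁
        ≡⟨ solve 2 (λ a b → a :- b := (a :- con 0ℚ) :+ (con 0ℚ :- b)) refl w₀ w₁ ⟩
      (w₀ - 0ℚ) + (0ℚ - w₁)
        ≡⟨ sym (cong₂ _+_ first rest) ⟩
      arcNet u (pathArc e (φ 0)) w₀ + ∑ₗ (segment (φ ∘ suc) (suc k)) (w ∘ fsuc) (arcNet u)
        ≡⟨ conserved (suc c) (ℕP.n<1+n c) ⟩
      0ℚ ∎))
      where
      open ≡-Reasoning
      w₀ = w fzero
      w₁ = w (fsuc fzero)
      u = inj₂ (j , suc c)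
      first : arcNet u (pathArc e (φ 0)) w₀ ≡ w₀ - 0ℚ
      first = trans (arcNet-start φ≗c+ u w₀)
                    (cong₂ _-_ (ind-≡ dV w₀ (pathHead-inner (not-last 1+c+1+k≡β))) (ind-≢ dV w₀ (pathTail-≢ (ℕP.<⇒≢ (ℕP.n<1+n c)))))
      rest : ∑ₗ (segment (φ ∘ suc) (suc k)) (w ∘ fsuc) (arcNet u) ≡ 0ℚ - w₁
      rest = trans (segment-net k (φ ∘ suc) (suc c) (w ∘ fsuc) (φ∘suc≗1+c+ φ≗c+) (shift-length 1+c+1+k≡β)
                                (conserved-tail φ≗c+ k w conserved) u
                                (λ i 1+c<i eq → ℕP.<⇒≢ 1+c<i (cong proj₂ (inj₂-injective eq))))
                   (cong₂ _-_ (ind-≢ dV {inj₁ (head N e)} {u} w₁ λ ()) (ind-≡ dV {pathTail e (suc c)} {u} w₁ refl))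

  block : Bool → Fin (arcs N) → List (ArcF N f)
  block c e = if c then pathArcs N f e else keepArc N f e ∷ []

  blockFlow : ∀ c e → (Fin (length (block c e)) → ℚ) → ℚ
  blockFlow true e w = w fzero
  blockFlow false e w = w fzero

  Conserved : ∀ c e → (Fin (length (block c e)) → ℚ) → Set
  Conserved c e w = ∀ i → ∑ₗ (block c e) w (arcNet (inj₂ (toℕ e , i))) ≡ 0ℚ

  block-net : ∀ c e w → Conserved c e w → ∀ v →
    ∑ₗ (block c e) w (arcNet (inj₁ v)) ≡ ind _≟_ (head N e) v (blockFlow c e w) - ind _≟_ (tail N e) v (blockFlow c e w)
  block-net false e w _ v = +-identityʳ _
  block-net true e w conserved v = Path.segment-net e _ id 0 w (λ _ → refl) refl (λ i _ → conserved i) (inj₁ v) (λ _ _ ())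

  block-net-elsewhere : ∀ c e w {j i} → j ≢ toℕ e → ∑ₗ (block c e) w (arcNet (inj₂ (j , i))) ≡ 0ℚ
  block-net-elsewhere false e w j≢e = refl
  block-net-elsewhere true e w {j} {i} j≢e =
    ∑ₗ-map-zero (pathArc e) (upTo (β N f e)) w (arcNet (inj₂ (j , i))) (λ c x → arcNet-otherPath e c x j≢e)

  -- The first two arcs of a boosted path are copies of e carrying the same flow.
  block-energy : ∀ c e w → Conserved c e w →
    let r = resistance (toDigraph N) f e ; x = blockFlow c e w in
    r * (x * x) + when c (r * (x * x)) ≤ ∑ₗ (block c e) w arcEnergy
  block-energy false e w _ = ≤-refl
  block-energy true e w conserved = begin
    arcEnergy (pathArc e 0) w₀ + arcEnergy (pathArc e 1) w₀
      ≡⟨ cong (λ z → arcEnergy (pathArc e 0) w₀ + arcEnergy (pathArc e 1) z) (sym w₁≡w₀) ⟩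
    arcEnergy (pathArc e 0) w₀ + arcEnergy (pathArc e 1) w₁
      ≡⟨ cong (_+_ (arcEnergy (pathArc e 0) w₀)) (sym (+-identityʳ _)) ⟩
    arcEnergy (pathArc e 0) w₀ + (arcEnergy (pathArc e 1) w₁ + 0ℚ)
      ≤⟨ +-monoʳ-≤ (arcEnergy (pathArc e 0) w₀) (+-monoʳ-≤ (arcEnergy (pathArc e 1) w₁)
           (∑ₗ-nonNeg (Path.segment e (suc ∘ suc) (β N f e ℕ.∸ 2)) (w ∘ fsuc ∘ fsuc) arcEnergy arcEnergy-nonNeg)) ⟩
    ∑ₗ (block true e) w arcEnergy ∎
    where
    open ≤-Reasoning
    w₀ = w fzero
    w₁ = w (fsuc fzero)
    w₁≡w₀ : w₁ ≡ w₀
    w₁≡w₀ = Path.segment-constant e _ id 0 w (λ _ → refl) refl (λ i _ → conserved i)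

  module Projection (S : Subset (arcs N)) where

    private
      G′ = boostedGraph N f S
      boosted : Fin (arcs N) → Bool
      boosted e = does (e ∈? S)
      blocks : Fin (arcs N) → List (ArcF N f)
      blocks e = block (boosted e) e

    weights : Flow G′ → (e : Fin (arcs N)) → Fin (length (blocks e)) → ℚ
    weights = blockWeights id blocks

    project : Flow G′ → Flow (toDigraph N)
    project h e = blockFlow (boosted e) e (weights h e)

    module _ {σ : V' N f → ℚ} (h : Flow G′) (h-flow : IsFlow dV G′ σ h) (σ-inner : ∀ j i → σ (inj₂ (j , i)) ≡ 0ℚ) where

      conserved : ∀ e → Conserved (boosted e) e (weights h e)
      conserved e i = begin
        ∑ₗ (blocks e) (weights h e) (arcNet u)
          ≡⟨ sym (∑-single _ e λ e′ e′≢e → block-net-elsewhere (boosted e′) e′ (weights h e′) (e′≢e ∘ sym ∘ toℕ-injective)) ⟩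
        ∑ (λ e′ → ∑ₗ (blocks e′) (weights h e′) (arcNet u))
          ≡⟨ sym (∑ₗ-concat id blocks h (arcNet u)) ⟩
        netIn dV G′ h u
          ≡⟨ h-flow u ⟩
        σ u
          ≡⟨ σ-inner (toℕ e) i ⟩
        0ℚ ∎
        where
        open ≡-Reasoning
        u = inj₂ (toℕ e , i)

      project-isFlow : IsFlow _≟_ (toDigraph N) (σ ∘ inj₁) (project h)
      project-isFlow v = begin
        netIn _≟_ (toDigraph N) (project h) v
          ≡⟨ ∑-cong (λ e → sym (block-net (boosted e) e (weights h e) (conserved e) v)) ⟩
        ∑ (λ e → ∑ₗ (blocks e) (weights h e) (arcNet (inj₁ v)))
          ≡⟨ sym (∑ₗ-concat id blocks h (arcNet (inj₁ v))) ⟩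
        netIn dV G′ h (inj₁ v)
          ≡⟨ h-flow (inj₁ v) ⟩
        σ (inj₁ v) ∎
        where open ≡-Reasoning

      project-energy : let r = resistance (toDigraph N) f ; g = project h in
        ∑ (λ e → r e * (g e * g e) + when (boosted e) (r e * (g e * g e))) ≤ energy G′ (resistance G′ (boostedFlow N f S)) h
      project-energy = ≤-trans (∑-mono-≤ (λ e → block-energy (boosted e) e (weights h e) (conserved e)))
                               (≤-reflexive (sym (∑ₗ-concat id blocks h arcEnergy)))

strictlyFeasible⇒0<res : ∀ {n} (N : Network n) f → StrictlyFeasible N f → ∀ e → (0ℚ < res⁺ N f e) × (0ℚ < res⁻ N f e)
strictlyFeasible⇒0<res N f feasible e =
  p<q⇒0<q-p (proj₂ (feasible e)) ,
  subst (_< res⁻ N f e) (+-inverseʳ (ℕ→ℚ (u⁻ N e))) (+-monoʳ-< (ℕ→ℚ (u⁻ N e)) (proj₁ (feasible e)))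

mainTheorem11 : ∀ {n : ℕ} (N : Network n) (s t : Fin n) (F : ℚ) (f : Fin (arcs N) → ℚ) →
    StrictlyFeasible N f →
    (f̃ : Fin (arcs N) → ℚ) →
    IsElectrical _≟_ (toDigraph N) (resistance (toDigraph N) f) (chi _≟_ F s t) f̃ →
    (S : Subset (arcs N)) →
    (f̃' : Flow (boostedGraph N f S)) →
    IsElectrical (decV' N f) (boostedGraph N f S)
      (resistance (boostedGraph N f S) (boostedFlow N f S))
      (chi (decV' N f) F (inj₁ s) (inj₁ t)) f̃' →
    (∑ (λ e → congestion N f f̃ e * congestion N f f̃ e)
        + (+ 1 / 8) * ∑∈ N f S (λ e → congestion N f f̃ e * congestion N f f̃ e))
      * energy (toDigraph N) (resistance (toDigraph N) f) f̃
    ≤ ∑ (λ e → congestion N f f̃ e * congestion N f f̃ e)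
      * energy (boostedGraph N f S) (resistance (boostedGraph N f S) (boostedFlow N f S)) f̃'
mainTheorem11 N s t F f feasible f̃ f̃-electrical S f̃′ (f̃′-flow , _) =
  boosted-energy-bound r f̃ (project f̃′) (congestion N f f̃) (λ e → does (e ∈? S)) 0≤r
    (proj₁ ∘ ρ-bounds) (proj₂ ∘ ρ-bounds)
    (electrical-variational-inequality _≟_ (toDigraph N) 0≤r f̃-electrical (project-isFlow f̃′ f̃′-flow λ _ _ → refl))
    (project-energy f̃′ f̃′-flow λ _ _ → refl)
  where
  open Boosting N f
  open Projection S
  r = resistance (toDigraph N) f
  bounds : ∀ e → let i = inv (ures N f e) in (i * i ≤ r e) × (r e ≤ i * i + i * i)
  bounds e = resistance-bounds (proj₁ 0<res) (proj₂ 0<res)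
    where 0<res = strictlyFeasible⇒0<res N f feasible e
  0≤r : ∀ e → 0ℚ ≤ r e
  0≤r e = ≤-trans (0≤p*p (inv (ures N f e))) (proj₁ (bounds e))
  ρ-bounds : ∀ e → let ρ = congestion N f f̃ e in (ρ * ρ ≤ r e * (f̃ e * f̃ e)) × (r e * (f̃ e * f̃ e) ≤ ρ * ρ + ρ * ρ)
  ρ-bounds e = congestion-bounds (f̃ e) (proj₁ (bounds e)) (proj₂ (bounds e))
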